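{- Without assuming propositional resizing, the Scott interpretation of PCF types can be typed as a function \[[\![-]\!]:\text{PCF types}\to\mathcal U_0\text{ - }(\mathsf{DCPO}_\bot)_{\mathcal U_1,\mathcal U_1}.\] That is, every $[\![\sigma]\!]$ is a $\mathcal U_0$-directed complete poset with a least element, whose underlying type lies in $\mathcal U_1$ and whose order takes values in $\mathcal U_1$.
   Context: The ambient theory is intensional Martin-Löf type theory with function extensionality, propositional extensionality, propositional truncation $\|-\|$, and universes $\mathcal U_0:\mathcal U_1$ closed under $+,\Sigma,\Pi$, with $\mathbf 0,\mathbf 1,\mathbb N:\mathcal U_0$. No propositional resizing is assumed. $\Omega$ is the type of propositions in $\mathcal U_0$ (so $\Omega:\mathcal U_1$). A family $u:I\to X$ in a poset is directed if $\|I\|$ holds and $\prod_{i,j}\|\sum_k u_i\le u_k\times u_j\le u_k\|$. A poset is a set with a proposition-valued reflexive, antisymmetric, transitive order. $\mathcal W\text{ - }(\mathsf{DCPO}_\bot)_{\mathcal U,\mathcal V}$ is the type of posets with a least element that have least upper bounds of all directed families indexed by types in $\mathcal W$, whose underlying type is in $\mathcal U$ and whose order takes values in $\mathcal V$. PCF types are $\iota$ and $\sigma\Rightarrow\tau$. The interpretation is $[\![\iota]\!]:=\mathcal L(\mathbb N)=\sum_{P:\Omega}(P\to\mathbb N)$, ordered by $l\sqsubseteq m:=(\mathsf{pr}_1(l)\to l=m)$. Further, $[\![\sigma\Rightarrow\tau]\!]$ is the type of continuous maps $[\![\sigma]\!]\to[\![\tau]\!]$ (maps preserving least upper bounds of directed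 families indexed by types in $\mathcal U_0$), ordered pointwise. -}

module Defs where

open import Level using (Level; _⊔_; 0ℓ; Setω) renaming (suc to lsuc)
open import Data.Nat using (ℕ)
open import Data.Product using (Σ; _×_; _,_; proj₁; proj₂)
open import Relation.Binary.PropositionalEquality using (_≡_)
open import Function using (_∘_)

-- Ambient HoTT/UF assumptions (not provable in --without-K Agda,
-- so they are taken as explicit hypotheses of the theorem).

isProp : ∀ {ℓ} → Set ℓ → Set ℓ
isProp A = (x y : A) → x ≡ y

isSet : ∀ {ℓ} → Set ℓ → Set ℓ
isSet A = (x y : A) → isProp (x ≡ y)

FunExt : Setω
FunExt = ∀ {a b} {A : Set a} {B : A → Set b} {f g : (x : A) → B x}
         → ((x : A) → f x ≡ g x) → f ≡ g

PropExt : Setω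
PropExt = ∀ {ℓ} {P Q : Set ℓ} → isProp P → isProp Q → (P → Q) → (Q → P) → P ≡ Q

record PropTrunc : Setω where
  field
    ∥_∥       : ∀ {ℓ} → Set ℓ → Set ℓ
    ∣_∣       : ∀ {ℓ} {A : Set ℓ} → A → ∥ A ∥
    ∥∥-isProp : ∀ {ℓ} {A : Set ℓ} → isProp ∥ A ∥
    ∥∥-rec    : ∀ {ℓ ℓ'} {A : Set ℓ} {B : Set ℓ'} → isProp B → (A → B) → ∥ A ∥ → B

Ω : Set₁
Ω = Σ Set isProp

infixr 5 _⇒_
data Ty : Set where
  ι   : Ty
  _⇒_ : Ty → Ty → Ty

module _ (pt : PropTrunc) where
  open PropTrunc pt

  isDirected : ∀ {w u v} {X : Set u} (_⊑_ : X → X → Set v) {I : Set w}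
               → (I → X) → Set (w ⊔ v)
  isDirected _⊑_ {I} f =
    ∥ I ∥ × ((i j : I) → ∥ Σ I (λ k → (f i ⊑ f k) × (f j ⊑ f k)) ∥)

  isLub : ∀ {w u v} {X : Set u} (_⊑_ : X → X → Set v) {I : Set w}
          → (I → X) → X → Set (w ⊔ u ⊔ v)
  isLub _⊑_ {I} f x =
    ((i : I) → f i ⊑ x) × ((y : _) → ((i : I) → f i ⊑ y) → x ⊑ y)

  record IsDCPO⊥ (𝓦 : Level) {𝓤 𝓥 : Level} (X : Set 𝓤) (_⊑_ : X → X → Set 𝓥)
         : Set (lsuc 𝓦 ⊔ 𝓤 ⊔ 𝓥) where
    field
      carrier-isSet : isSet X
      ⊑-isProp      : (x y : X) → isProp (x ⊑ y)
      ⊑-refl        : (x : X) → x ⊑ x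
      ⊑-trans       : (x y z : X) → x ⊑ y → y ⊑ z → x ⊑ z
      ⊑-antisym     : (x y : X) → x ⊑ y → y ⊑ x → x ≡ y
      ⊥             : X
      ⊥-least       : (x : X) → ⊥ ⊑ x
      sup           : (I : Set 𝓦) (f : I → X) → isDirected _⊑_ f → Σ X (isLub _⊑_ f)

  record DCPO⊥ (𝓦 𝓤 𝓥 : Level) : Set (lsuc (𝓦 ⊔ 𝓤 ⊔ 𝓥)) where
    field
      Carrier : Set 𝓤
      _⊑_     : Carrier → Carrier → Set 𝓥
      isDCPO⊥ : IsDCPO⊥ 𝓦 Carrier _⊑_

  isContinuous : ∀ {u v u' v'} {X : Set u} (_⊑X_ : X → X → Set v)
                 {Y : Set u'} (_⊑Y_ : Y → Y → Set v') → (X → Y) → Set (lsuc 0ℓ ⊔ u ⊔ v ⊔ u' ⊔ v')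
  isContinuous _⊑X_ _⊑Y_ f =
    (I : Set) (g : I → _) → isDirected _⊑X_ g
    → (x : _) → isLub _⊑X_ g x → isLub _⊑Y_ (f ∘ g) (f x)

  𝓛ℕ : Set₁
  𝓛ℕ = Σ Ω (λ P → proj₁ P → ℕ)

  mutual
    ⟦_⟧ : Ty → Set₁
    ⟦ ι ⟧     = 𝓛ℕ
    ⟦ σ ⇒ τ ⟧ = Σ (⟦ σ ⟧ → ⟦ τ ⟧) (isContinuous (Ord σ) (Ord τ))

    Ord : (σ : Ty) → ⟦ σ ⟧ → ⟦ σ ⟧ → Set₁
    Ord ι       l m = proj₁ (proj₁ l) → l ≡ m
    Ord (σ ⇒ τ) f g = (x : ⟦ σ ⟧) → Ord τ (proj₁ f x) (proj₁ g x)

-- No resizing is needed because every supremum is computed from data no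
-- larger than the family. The supremum of a directed family f : I → 𝓛 X
-- of partial elements of a set is defined on the proposition
-- ∥ Σ I (isDefined ∘ f) ∥, which lies in 𝓤₀ since I does; its value is
-- the common value of the defined members, because directedness makes
-- (i , x) ↦ value (f i) x weakly constant and a weakly constant map into a
-- set factors through the truncation of its domain. Continuous maps into a
-- dcpo form a dcpo under the pointwise order with pointwise suprema, which
-- are continuous because suprema commute with suprema.
module Submission where

open import Defs
open import Level using (Level; _⊔_; 0ℓ) renaming (suc to lsuc)
open import Data.Nat using (ℕ)
open import Data.Nat.Properties using (≡-irrelevant)
open import Data.Product using (Σ; _×_; _,_; proj₁; proj₂)
open import Data.Product.Properties using (Σ-≡,≡→≡; ×-≡,≡→≡)
open import Data.Empty using (⊥)
open import Function using (_∘_; id)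
open import Relation.Binary.PropositionalEquality
  using (_≡_; refl; sym; trans; cong; subst)
open import Axiom.UniquenessOfIdentityProofs using (module Constant⇒UIP)

private
  variable
    a b r : Level

isProp→isSet : {A : Set a} → isProp A → isSet A
isProp→isSet {A = A} A-isProp _ _ = Constant⇒UIP.≡-irrelevant normalise (λ _ _ → refl)
  where
  normalise : {x y : A} → x ≡ y → x ≡ y
  normalise {x} {y} _ = trans (sym (A-isProp x x)) (A-isProp x y)

reflexiveIdentity⇒isSet : {A : Set a} (R : A → A → Set r)
  → (∀ x y → isProp (R x y)) → (∀ x → R x x) → (∀ {x y} → R x y → x ≡ y)
  → isSet A
reflexiveIdentity⇒isSet R R-isProp R-refl R⇒≡ _ _ =
  Constant⇒UIP.≡-irrelevant normalise normalise-constant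
  where
  normalise : ∀ {x y} → x ≡ y → x ≡ y
  normalise {x} p = R⇒≡ (subst (R x) p (R-refl x))
  normalise-constant : ∀ {x y} (p q : x ≡ y) → normalise p ≡ normalise q
  normalise-constant {x} {y} p q = cong R⇒≡ (R-isProp x y _ _)

Σ-isProp-≡ : {A : Set a} {B : A → Set b} → (∀ x → isProp (B x))
  → {u v : Σ A B} → proj₁ u ≡ proj₁ v → u ≡ v
Σ-isProp-≡ B-isProp p = Σ-≡,≡→≡ (p , B-isProp _ _ _)

×-isProp : {A : Set a} {B : Set b} → isProp A → isProp B → isProp (A × B)
×-isProp A-isProp B-isProp (x , y) (x′ , y′) = ×-≡,≡→≡ (A-isProp x x′ , B-isProp y y′)

ℕ-isSet : isSet ℕ
ℕ-isSet _ _ = ≡-irrelevant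

module HLevel (fe : FunExt) where

  Π-isProp : {A : Set a} {B : A → Set b} → (∀ x → isProp (B x)) → isProp ((x : A) → B x)
  Π-isProp B-isProp f g = fe λ x → B-isProp x (f x) (g x)

  isProp-isProp : {A : Set a} → isProp (isProp A)
  isProp-isProp h h′ = fe λ x → fe λ y → isProp→isSet h x y (h x y) (h′ x y)

module Truncation (pt : PropTrunc) (fe : FunExt) where
  open PropTrunc pt
  open HLevel fe

  ∥∥-rec-wconstant : {A : Set a} {B : Set b} → isSet B
    → (f : A → B) → (∀ x y → f x ≡ f y) → ∥ A ∥ → Σ B (λ z → ∀ x → f x ≡ z)
  ∥∥-rec-wconstant {A = A} {B} B-isSet f f-wconstant t = ∥∥-rec image-isProp image t
    where
    image : A → Σ B (λ z → ∀ x → f x ≡ z)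
    image x = f x , λ y → f-wconstant y x
    image-isProp : isProp (Σ B (λ z → ∀ x → f x ≡ z))
    image-isProp (z , p) (z′ , p′) =
      Σ-isProp-≡ (λ _ → Π-isProp λ _ → B-isSet _ _)
                 (∥∥-rec (B-isSet z z′) (λ x → trans (sym (p x)) (p′ x)) t)

module Lifting (pt : PropTrunc) (fe : FunExt) (pe : PropExt) where
  open PropTrunc pt
  open HLevel fe
  open Truncation pt fe

  𝓛 : Set a → Set (lsuc 0ℓ ⊔ a)
  𝓛 X = Σ Ω (λ P → proj₁ P → X)

  module _ {X : Set a} where

    isDefined : 𝓛 X → Set
    isDefined l = proj₁ (proj₁ l)

    isDefined-isProp : (l : 𝓛 X) → isProp (isDefined l)
    isDefined-isProp l = proj₂ (proj₁ l)

    value : (l : 𝓛 X) → isDefined l → X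
    value = proj₂

    _⊑_ : 𝓛 X → 𝓛 X → Set (lsuc 0ℓ ⊔ a)
    l ⊑ m = isDefined l → l ≡ m

    _≈_ : 𝓛 X → 𝓛 X → Set a
    l ≈ m = (isDefined l → isDefined m) × (isDefined m → isDefined l)
          × (∀ x y → value l x ≡ value m y)

    ≡⇒value-≡ : {l m : 𝓛 X} → l ≡ m → ∀ x y → value l x ≡ value m y
    ≡⇒value-≡ {l} refl x y = cong (value l) (isDefined-isProp l x y)

    ≈-refl : (l : 𝓛 X) → l ≈ l
    ≈-refl l = id , id , ≡⇒value-≡ {l} refl

    Ω-≡ : {P Q : Ω} → (proj₁ P → proj₁ Q) → (proj₁ Q → proj₁ P) → P ≡ Q
    Ω-≡ {P , P-isProp} {Q , Q-isProp} P→Q Q→P =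
      Σ-isProp-≡ (λ _ → isProp-isProp) (pe P-isProp Q-isProp P→Q Q→P)

    𝓛-≡ : {l m : 𝓛 X} (e : proj₁ l ≡ proj₁ m)
      → (∀ x → value l x ≡ value m (subst proj₁ e x)) → l ≡ m
    𝓛-≡ {P , _} refl values-≡ = cong (P ,_) (fe values-≡)

    ≈⇒≡ : {l m : 𝓛 X} → l ≈ m → l ≡ m
    ≈⇒≡ (l→m , m→l , values-≡) = 𝓛-≡ (Ω-≡ l→m m→l) (λ x → values-≡ x _)

    ⊑-defined : {l m : 𝓛 X} → l ⊑ m → isDefined l → isDefined m
    ⊑-defined l⊑m x = subst isDefined (l⊑m x) x

    ⊑-trans : (l m n : 𝓛 X) → l ⊑ m → m ⊑ n → l ⊑ n
    ⊑-trans l m n l⊑m m⊑n x = trans (l⊑m x) (m⊑n (⊑-defined l⊑m x))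

    ⊑-antisym : (l m : 𝓛 X) → l ⊑ m → m ⊑ l → l ≡ m
    ⊑-antisym l m l⊑m m⊑l =
      ≈⇒≡ (⊑-defined l⊑m , ⊑-defined m⊑l , λ x → ≡⇒value-≡ (l⊑m x) x)

    ⊥𝓛 : 𝓛 X
    ⊥𝓛 = (⊥ , λ ()) , λ ()

    module _ (X-isSet : isSet X) where

      ≈-isProp : (l m : 𝓛 X) → isProp (l ≈ m)
      ≈-isProp l m = ×-isProp (Π-isProp λ _ → isDefined-isProp m)
        (×-isProp (Π-isProp λ _ → isDefined-isProp l) (Π-isProp λ _ → Π-isProp λ _ → X-isSet _ _))

      𝓛-isSet : isSet (𝓛 X)
      𝓛-isSet = reflexiveIdentity⇒isSet _≈_ ≈-isProp ≈-refl ≈⇒≡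

      module _ {I : Set} (f : I → 𝓛 X) (f-directed : isDirected pt _⊑_ f) where

        directed-values-agree : ∀ i j (x : isDefined (f i)) (y : isDefined (f j))
          → value (f i) x ≡ value (f j) y
        directed-values-agree i j x y =
          ∥∥-rec (X-isSet _ _) (λ (k , i⊑k , j⊑k) → ≡⇒value-≡ (trans (i⊑k x) (sym (j⊑k y))) x y)
                 (proj₂ f-directed i j)

        common-value : ∥ Σ I (isDefined ∘ f) ∥
          → Σ X (λ z → ∀ ((i , x) : Σ I (isDefined ∘ f)) → value (f i) x ≡ z)
        common-value = ∥∥-rec-wconstant X-isSet (λ (i , x) → value (f i) x)
                         (λ (i , x) (j , y) → directed-values-agree i j x y)

        ⋁ : 𝓛 X
        ⋁ = (∥ Σ I (isDefined ∘ f) ∥ , ∥∥-isProp) , proj₁ ∘ common-value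

        ⋁-upper : ∀ i → f i ⊑ ⋁
        ⋁-upper i x = ≈⇒≡ ((λ _ → ∣ i , x ∣) , (λ _ → x) , λ x′ t → proj₂ (common-value t) (i , x′))

        ⋁-least : ∀ m → (∀ i → f i ⊑ m) → ⋁ ⊑ m
        ⋁-least m f⊑m = ∥∥-rec (𝓛-isSet ⋁ m) (λ (i , x) → trans (sym (⋁-upper i x)) (f⊑m i x))

      𝓛-isDCPO⊥ : IsDCPO⊥ pt 0ℓ (𝓛 X) _⊑_
      𝓛-isDCPO⊥ = record
        { carrier-isSet = 𝓛-isSet
        ; ⊑-isProp      = λ l m → Π-isProp λ _ → 𝓛-isSet l m
        ; ⊑-refl        = λ _ _ → refl
        ; ⊑-trans       = ⊑-trans
        ; ⊑-antisym     = ⊑-antisym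
        ; ⊥             = ⊥𝓛
        ; ⊥-least       = λ _ ()
        ; sup           = λ I f f-directed → ⋁ f f-directed , ⋁-upper f f-directed , ⋁-least f f-directed
        }

module ContinuousMaps (pt : PropTrunc) (fe : FunExt)
  {u v u′ v′ 𝓦 : Level} {X : Set u} (_⊑X_ : X → X → Set v)
  {Y : Set u′} {_⊑Y_ : Y → Y → Set v′} (𝒀 : IsDCPO⊥ pt 𝓦 Y _⊑Y_) where
  open PropTrunc pt
  open HLevel fe
  module 𝒀 = IsDCPO⊥ 𝒀

  [X→Y] : Set (lsuc 0ℓ ⊔ u ⊔ v ⊔ u′ ⊔ v′)
  [X→Y] = Σ (X → Y) (isContinuous pt _⊑X_ _⊑Y_)

  _⊑→_ : [X→Y] → [X→Y] → Set (u ⊔ v′)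
  f ⊑→ g = ∀ x → proj₁ f x ⊑Y proj₁ g x

  isLub-isProp : {I : Set} (f : I → Y) (y : Y) → isProp (isLub pt _⊑Y_ f y)
  isLub-isProp f y = ×-isProp (Π-isProp λ _ → 𝒀.⊑-isProp _ _)
                              (Π-isProp λ _ → Π-isProp λ _ → 𝒀.⊑-isProp _ _)

  isContinuous-isProp : (h : X → Y) → isProp (isContinuous pt _⊑X_ _⊑Y_ h)
  isContinuous-isProp h = Π-isProp λ _ → Π-isProp λ g → Π-isProp λ _ → Π-isProp λ x → Π-isProp λ _ →
                          isLub-isProp (h ∘ g) (h x)

  const-isContinuous : (y : Y) → isContinuous pt _⊑X_ _⊑Y_ (λ _ → y)
  const-isContinuous y J g (J-inhabited , _) x _ =
    (λ _ → 𝒀.⊑-refl y) , λ z z-upper → ∥∥-rec (𝒀.⊑-isProp y z) z-upper J-inhabited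

  pointwise-lub-isContinuous : {I : Set 𝓦} (f : I → [X→Y]) (s : X → Y)
    → (∀ x → isLub pt _⊑Y_ (λ i → proj₁ (f i) x) (s x)) → isContinuous pt _⊑X_ _⊑Y_ s
  pointwise-lub-isContinuous f s s-lub J g g-directed x x-lub = upper , least
    where
    f-preserves : ∀ i → isLub pt _⊑Y_ (proj₁ (f i) ∘ g) (proj₁ (f i) x)
    f-preserves i = proj₂ (f i) J g g-directed x x-lub
    upper : ∀ j → s (g j) ⊑Y s x
    upper j = proj₂ (s-lub (g j)) (s x) λ i →
      𝒀.⊑-trans _ _ _ (proj₁ (f-preserves i) j) (proj₁ (s-lub x) i)
    least : ∀ y → (∀ j → s (g j) ⊑Y y) → s x ⊑Y y
    least y y-upper = proj₂ (s-lub x) y λ i → proj₂ (f-preserves i) y λ j →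
      𝒀.⊑-trans _ _ _ (proj₁ (s-lub (g j)) i) (y-upper j)

  module _ {I : Set 𝓦} (f : I → [X→Y]) (f-directed : isDirected pt _⊑→_ f) where

    pointwise-directed : ∀ x → isDirected pt _⊑Y_ (λ i → proj₁ (f i) x)
    pointwise-directed x =
      proj₁ f-directed ,
      λ i j → ∥∥-rec ∥∥-isProp (λ (k , i⊑k , j⊑k) → ∣ k , i⊑k x , j⊑k x ∣) (proj₂ f-directed i j)

    pointwise-sup : ∀ x → Σ Y (isLub pt _⊑Y_ (λ i → proj₁ (f i) x))
    pointwise-sup x = 𝒀.sup I (λ i → proj₁ (f i) x) (pointwise-directed x)

    ⋁ : [X→Y]
    ⋁ = proj₁ ∘ pointwise-sup , pointwise-lub-isContinuous f (proj₁ ∘ pointwise-sup) (proj₂ ∘ pointwise-sup)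

    ⋁-isLub : isLub pt _⊑→_ f ⋁
    ⋁-isLub = (λ i x → proj₁ (proj₂ (pointwise-sup x)) i)
            , λ g f⊑g x → proj₂ (proj₂ (pointwise-sup x)) (proj₁ g x) (λ i → f⊑g i x)

  [X→Y]-isDCPO⊥ : IsDCPO⊥ pt 𝓦 [X→Y] _⊑→_
  [X→Y]-isDCPO⊥ = record
    { carrier-isSet = reflexiveIdentity⇒isSet (λ f g → ∀ x → proj₁ f x ≡ proj₁ g x)
                        (λ _ _ → Π-isProp λ _ → 𝒀.carrier-isSet _ _) (λ _ _ → refl)
                        (λ f≗g → Σ-isProp-≡ isContinuous-isProp (fe f≗g))
    ; ⊑-isProp      = λ f g → Π-isProp λ x → 𝒀.⊑-isProp _ _
    ; ⊑-refl        = λ f x → 𝒀.⊑-refl (proj₁ f x)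
    ; ⊑-trans       = λ f g h f⊑g g⊑h x → 𝒀.⊑-trans _ _ _ (f⊑g x) (g⊑h x)
    ; ⊑-antisym     = λ f g f⊑g g⊑f →
                        Σ-isProp-≡ isContinuous-isProp (fe λ x → 𝒀.⊑-antisym _ _ (f⊑g x) (g⊑f x))
    ; ⊥             = (λ _ → 𝒀.⊥) , const-isContinuous 𝒀.⊥
    ; ⊥-least       = λ f x → 𝒀.⊥-least (proj₁ f x)
    ; sup           = λ I f f-directed → ⋁ f f-directed , ⋁-isLub f f-directed
    }

theorem9p1 : (pt : PropTrunc) → FunExt → PropExt
    → (σ : Ty) → IsDCPO⊥ pt 0ℓ (⟦_⟧ pt σ) (Ord pt σ)
theorem9p1 pt fe pe ι = Lifting.𝓛-isDCPO⊥ pt fe pe ℕ-isSet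
theorem9p1 pt fe pe (σ ⇒ τ) =
  ContinuousMaps.[X→Y]-isDCPO⊥ pt fe (Ord pt σ) (theorem9p1 pt fe pe τ)
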